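{- Let $k,\zeta,\eta\ge 1$ be integers with $\zeta\ge 2$, and let $(H_1,r_1),\ldots,(H_k,r_k)$ be $(k\zeta^{\eta+1},\eta)$-uniform rooted trees, each a subgraph of a graph $G$, such that $r_i\notin V(H_j)$ for all distinct $i,j\in\{1,\ldots,k\}$. Then for $1\le i\le k$ there is a $(\zeta,\eta)$-uniform rooted subtree $(H_i',r_i)$ of $(H_i,r_i)$ such that the trees $H_1',\ldots,H_k'$ are pairwise vertex-disjoint.
   Context: All graphs are finite, without loops or parallel edges; a subgraph need not be induced. A rooted tree $(H,r)$ is a tree $H$ with a distinguished vertex $r$ (the root). A rooted subtree of $(H,r)$ is a rooted tree $(J,r)$ where $J$ is a subtree of $H$ with $r\in V(J)$. If $u,v\in V(H)$ are adjacent and $u$ lies on the path of $H$ between $v$ and $r$, then $v$ is a child of $u$. For integers $\zeta,\eta\ge 1$, $(H,r)$ is $(\zeta,\eta)$-uniform if every vertex with a child has exactly $\zeta$ children, and every vertex with no child is joined to $r$ by a path of $H$ of length (number of edges) exactly $\eta$. -}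

module Defs where

open import Data.Nat using (ℕ; suc)
open import Data.Fin using (Fin)
open import Data.List using (List; []; _∷_; [_]; length)
open import Data.List.Relation.Unary.All using (All)
open import Data.List.Relation.Unary.Unique.Propositional using (Unique)
open import Data.List.Membership.Propositional using (_∈_)
open import Data.Product using (Σ; ∃; _×_)
open import Data.Empty using (⊥)
open import Relation.Nullary using (¬_)
open import Relation.Binary.PropositionalEquality using (_≡_)
open import Function.Bundles using (_⇔_)

record Graph (n : ℕ) : Set₁ where
  field
    Adj    : Fin n → Fin n → Set
    sym    : ∀ {u v} → Adj u v → Adj v u
    irrefl : ∀ {v} → ¬ Adj v v

record Subgraph {n : ℕ} (G : Graph n) : Set₁ where
  field
    V     : Fin n → Set
    E     : Fin n → Fin n → Set
    E-sym : ∀ {u v} → E u v → E v u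
    E⊆G   : ∀ {u v} → E u v → Graph.Adj G u v
    E-end : ∀ {u v} → E u v → V u × V v

open Subgraph public

data Chain {n : ℕ} (E : Fin n → Fin n → Set) : List (Fin n) → Set where
  single : ∀ v → Chain E [ v ]
  cons   : ∀ {u v vs} → E u v → Chain E (v ∷ vs) → Chain E (u ∷ v ∷ vs)

data First {n : ℕ} : List (Fin n) → Fin n → Set where
  first : ∀ {v vs} → First (v ∷ vs) v

data Last {n : ℕ} : List (Fin n) → Fin n → Set where
  last-one  : ∀ {v} → Last [ v ] v
  last-cons : ∀ {u v vs} → Last vs v → Last (u ∷ vs) v

-- ps is (the vertex sequence of) a path of H from u to v;
-- its length (number of edges) is  length ps - 1.
record IsPath {n : ℕ} {G : Graph n} (H : Subgraph G) (u v : Fin n)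
              (ps : List (Fin n)) : Set where
  field
    chain   : Chain (E H) ps
    inV     : All (V H) ps
    distinct : Unique ps
    starts  : First ps u
    ends    : Last ps v

Connected : ∀ {n} {G : Graph n} → Subgraph G → Set
Connected {n} H = ∀ (u v : Fin n) → V H u → V H v → ∃ λ ps → IsPath H u v ps

HasCycle : ∀ {n} {G : Graph n} → Subgraph G → Set
HasCycle {n} H = Σ (Fin n) λ u → Σ (Fin n) λ v → Σ (List (Fin n)) λ ps →
  IsPath H u v ps × (3 Data.Nat.≤ length ps) × E H v u

IsTree : ∀ {n} {G : Graph n} → Subgraph G → Set
IsTree {n} H = (∃ λ (v : Fin n) → V H v) × Connected H × ¬ HasCycle H

_⊑_ : ∀ {n} {G : Graph n} → Subgraph G → Subgraph G → Set
_⊑_ {n} J H = (∀ (v : Fin n) → V J v → V H v) × (∀ (u v : Fin n) → E J u v → E H u v)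

Child : ∀ {n} {G : Graph n} → Subgraph G → Fin n → Fin n → Fin n → Set
Child H r u v = E H u v × ∃ λ ps → IsPath H v r ps × u ∈ ps

HasExactly : ∀ {n} → (Fin n → Set) → ℕ → Set
HasExactly {n} P m = ∃ λ (xs : List (Fin n)) →
  length xs ≡ m × Unique xs × (∀ v → (P v ⇔ v ∈ xs))

Uniform : ∀ {n} {G : Graph n} → Subgraph G → Fin n → ℕ → ℕ → Set
Uniform {n} H r ζ η =
  (∀ u → V H u → (∃ λ v → Child H r u v) → HasExactly (Child H r u) ζ)
  × (∀ u → V H u → ¬ (∃ λ v → Child H r u v) →
       ∃ λ ps → IsPath H u r ps × length ps ≡ suc η)

IsRootedTree : ∀ {n} {G : Graph n} → Subgraph G → Fin n → Set
IsRootedTree H r = IsTree H × V H r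

IsRootedSubtree : ∀ {n} {G : Graph n} → Subgraph G → Subgraph G → Fin n → Set
IsRootedSubtree J H r = IsTree J × J ⊑ H × V J r

module Submission where

-- Greedy construction. Treat the trees in the order 0, 1, …, k − 1 and grow in H i, from r i,
-- a subtree in which every vertex of depth < η keeps the first ζ of its children that avoid
-- the vertices X used by the earlier subtrees. Each earlier subtree has at most
-- 1 + ζ + ⋯ + ζ^η < ζ^(η+1) vertices, so |X| < (k − 1) ζ^(η+1) and every vertex of depth < η,
-- having k ζ^(η+1) children, still has ζ admissible ones. Since leaves of H i have depth
-- exactly η, the grown tree is (ζ, η)-uniform; it is disjoint from the earlier ones by
-- construction, apart from its root, which lies in no other H j.

open import Defs
open import Data.Nat using (ℕ; zero; suc; _≤_; _<_; _*_; _+_; _^_; z≤n; s≤s; _<?_)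
open import Data.Nat.Properties
  using ( +-mono-≤; +-monoˡ-≤; *-monoʳ-≤; *-mono-≤; *-monoˡ-≤; +-comm; +-suc; *-suc; *-identityʳ; +-identityʳ
        ; ≤-refl; ≤-trans; ≤-antisym; <⇒≤; <⇒≢; <-cmp; +-cancelʳ-≤; m≤n⇒m⊓n≡m; m⊓n≤m; m≤m*n; m^n≢0
        ; m+1+n≢m; m≤n⇒m<n∨m≡n; module ≤-Reasoning )
open import Data.Fin using (Fin; zero; suc; toℕ; fromℕ<; _≟_)
open import Data.Fin.Properties using (fromℕ<-toℕ; toℕ<n; toℕ-injective)
open import Data.List using (List; []; _∷_; [_]; length; _++_; filter; take; concatMap; allFin)
open import Data.List.Properties using (length-++; length-++-sucʳ; length-take; concatMap-cong; filter-≐)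
open import Data.List.Relation.Unary.Any using (here; there)
open import Data.List.Relation.Unary.Any.Properties using (¬Any[])
open import Data.List.Relation.Unary.All as All using (All; []; _∷_)
open import Data.List.Relation.Unary.All.Properties using (¬Any⇒All¬)
open import Data.List.Relation.Unary.AllPairs using ([]; _∷_)
open import Data.List.Relation.Unary.Unique.Propositional using (Unique)
open import Data.List.Relation.Unary.Unique.Propositional.Properties using (filter⁺; take⁺; allFin⁺; Unique[x∷xs]⇒x∉xs)
open import Data.List.Relation.Binary.Subset.Propositional using (_⊆_)
open import Data.List.Relation.Binary.Sublist.Propositional using (lookup)
open import Data.List.Relation.Binary.Sublist.Propositional.Properties using (take-⊆)
open import Data.List.Membership.Propositional using (_∈_; _∉_; find; lose)
open import Data.List.Membership.Propositional.Properties
  using (∈-∃++; ∈-++⁻; ∈-++⁺ˡ; ∈-++⁺ʳ; ∈-filter⁺; ∈-filter⁻; ∈-concatMap⁺; ∈-concatMap⁻; ∈-allFin)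
open import Data.Product using (Σ; ∃; ∃₂; _×_; _,_; proj₁; proj₂)
open import Data.Sum using (_⊎_; inj₁; inj₂)
open import Data.Empty using (⊥; ⊥-elim)
open import Function using (_∘_)
open import Function.Bundles using (_⇔_; mk⇔; Equivalence)
open import Relation.Nullary using (¬_; Dec; yes; no; ¬?)
open import Relation.Nullary.Negation using (¬¬-map)
open import Relation.Nullary.Decidable using (¬¬-excluded-middle)
open import Relation.Unary using (Pred; Decidable)
open import Relation.Binary.PropositionalEquality using (_≡_; _≢_; refl; sym; trans; cong; subst; ≢-sym)
open import Relation.Binary.Definitions using (DecidableEquality; tri<; tri≈; tri>)

unique⊆⇒length≤ : ∀ {A : Set} {xs ys : List A} → Unique xs → xs ⊆ ys → length xs ≤ length ys
unique⊆⇒length≤ {xs = []} _ _ = z≤n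
unique⊆⇒length≤ {xs = x ∷ xs} ux@(_ ∷ uxs) xs⊆ys with ∈-∃++ (xs⊆ys (here refl))
... | as , bs , refl =
  subst (suc (length xs) ≤_) (sym (length-++-sucʳ as x bs))
    (s≤s (unique⊆⇒length≤ uxs (λ z∈xs → delete-x z∈xs (xs⊆ys (there z∈xs)))))
  where
    delete-x : ∀ {z} → z ∈ xs → z ∈ as ++ x ∷ bs → z ∈ as ++ bs
    delete-x z∈xs z∈ys with ∈-++⁻ as z∈ys
    ... | inj₁ z∈as = ∈-++⁺ˡ z∈as
    ... | inj₂ (here refl) = ⊥-elim (Unique[x∷xs]⇒x∉xs ux z∈xs)
    ... | inj₂ (there z∈bs) = ∈-++⁺ʳ as z∈bs

module _ {A : Set} {p} {P : Pred A p} (P? : Decidable P) where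

  length-filter-partition : ∀ xs → length (filter P? xs) + length (filter (¬? ∘ P?) xs) ≡ length xs
  length-filter-partition [] = refl
  length-filter-partition (x ∷ xs) with P? x
  ... | yes _ = cong suc (length-filter-partition xs)
  ... | no _ = trans (+-suc _ _) (cong suc (length-filter-partition xs))

module _ {A : Set} (_≟_ : DecidableEquality A) where
  open import Data.List.Membership.DecPropositional _≟_ using (_∈?_; _∉?_)

  length≤length-filter-∉+length : ∀ (X : List A) {xs} → Unique xs → length xs ≤ length (filter (_∉? X) xs) + length X
  length≤length-filter-∉+length X {xs} uxs = begin
    length xs                                                    ≡⟨ sym (length-filter-partition (_∈? X) xs) ⟩
    length (filter (_∈? X) xs) + length (filter (_∉? X) xs)    ≤⟨ +-monoˡ-≤ _ in-X≤X ⟩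
    length X + length (filter (_∉? X) xs)                        ≡⟨ +-comm (length X) _ ⟩
    length (filter (_∉? X) xs) + length X                        ∎
    where
      open ≤-Reasoning
      in-X≤X : length (filter (_∈? X) xs) ≤ length X
      in-X≤X = unique⊆⇒length≤ (filter⁺ (_∈? X) uxs) (λ m → proj₂ (∈-filter⁻ (_∈? X) {xs = xs} m))

length-concatMap≤ : ∀ {A B : Set} (f : A → List B) {b} → (∀ x → length (f x) ≤ b) →
                    ∀ xs → length (concatMap f xs) ≤ length xs * b
length-concatMap≤ f f≤b [] = z≤n
length-concatMap≤ f f≤b (x ∷ xs) = subst (_≤ _) (sym (length-++ (f x))) (+-mono-≤ (f≤b x) (length-concatMap≤ f f≤b xs))

HasExactly⇒length≡ : ∀ {n} {P : Fin n → Set} {m ys} →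
                     HasExactly P m → Unique ys → (∀ v → P v ⇔ v ∈ ys) → length ys ≡ m
HasExactly⇒length≡ (xs , refl , uxs , P⇔xs) uys P⇔ys = ≤-antisym
  (unique⊆⇒length≤ uys λ {v} v∈ys → Equivalence.to (P⇔xs v) (Equivalence.from (P⇔ys v) v∈ys))
  (unique⊆⇒length≤ uxs λ {v} v∈xs → Equivalence.to (P⇔ys v) (Equivalence.from (P⇔xs v) v∈xs))

last-∈ : ∀ {n} {ps : List (Fin n)} {v} → Last ps v → v ∈ ps
last-∈ last-one = here refl
last-∈ (last-cons l) = there (last-∈ l)

module Paths {n : ℕ} {G : Graph n} (H : Subgraph G) where
  open import Data.List.Membership.DecPropositional (_≟_ {n}) using (_∈?_)

  data Walk : Fin n → Fin n → Set where
    stop : ∀ {u} → V H u → Walk u u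
    _◅_ : ∀ {u v w} → E H u v → Walk v w → Walk u w

  infixr 5 _◅_ _◅◅_

  vertices : ∀ {u v} → Walk u v → List (Fin n)
  vertices {u} (stop _) = [ u ]
  vertices {u} (_ ◅ w) = u ∷ vertices w

  _◅◅_ : ∀ {u v w} → Walk u v → Walk v w → Walk u w
  stop _ ◅◅ w′ = w′
  (e ◅ w) ◅◅ w′ = e ◅ (w ◅◅ w′)

  vertices-◅◅ : ∀ {u v w} (w₁ : Walk u v) (w₂ : Walk v w) → vertices (w₁ ◅◅ w₂) ⊆ vertices w₁ ++ vertices w₂
  vertices-◅◅ (stop _) w₂ m = there m
  vertices-◅◅ (e ◅ w₁) w₂ (here refl) = here refl
  vertices-◅◅ (e ◅ w₁) w₂ (there m) = there (vertices-◅◅ w₁ w₂ m)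

  start∈vertices : ∀ {u v} (w : Walk u v) → u ∈ vertices w
  start∈vertices (stop _) = here refl
  start∈vertices (_ ◅ _) = here refl

  reverse : ∀ {u v} → Walk u v → Walk v u
  reverse (stop p) = stop p
  reverse (e ◅ w) = reverse w ◅◅ E-sym H e ◅ stop (proj₁ (E-end H e))

  vertices-reverse : ∀ {u v} (w : Walk u v) → vertices (reverse w) ⊆ vertices w
  vertices-reverse (stop _) m = m
  vertices-reverse (e ◅ w) m with ∈-++⁻ (vertices (reverse w)) (vertices-◅◅ (reverse w) _ m)
  ... | inj₁ m′ = there (vertices-reverse w m′)
  ... | inj₂ (here refl) = there (start∈vertices w)
  ... | inj₂ (there (here refl)) = here refl

  chainWalk : ∀ {u v ps} → Chain (E H) ps → All (V H) ps → First ps u → Last ps v → Walk u v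
  chainWalk (single _) (vu ∷ []) first last-one = stop vu
  chainWalk (single _) _ first (last-cons ())
  chainWalk (cons e c) (_ ∷ vs) first (last-cons l) = e ◅ chainWalk c vs first l

  vertices-chainWalk : ∀ {u v ps} (c : Chain (E H) ps) (vs : All (V H) ps) (f : First ps u) (l : Last ps v) →
                       vertices (chainWalk c vs f l) ≡ ps
  vertices-chainWalk (single _) (_ ∷ []) first last-one = refl
  vertices-chainWalk (single _) _ first (last-cons ())
  vertices-chainWalk (cons e c) (_ ∷ vs) first (last-cons l) = cong (_ ∷_) (vertices-chainWalk c vs first l)

  pathWalk : ∀ {u v ps} → IsPath H u v ps → Walk u v
  pathWalk p = chainWalk (IsPath.chain p) (IsPath.inV p) (IsPath.starts p) (IsPath.ends p)

  vertices-pathWalk : ∀ {u v ps} (p : IsPath H u v ps) → vertices (pathWalk p) ≡ ps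
  vertices-pathWalk p = vertices-chainWalk (IsPath.chain p) (IsPath.inV p) (IsPath.starts p) (IsPath.ends p)

  singlePath : ∀ {u} → V H u → IsPath H u u [ u ]
  singlePath vu = record { chain = single _ ; inV = vu ∷ [] ; distinct = [] ∷ [] ; starts = first ; ends = last-one }

  consPath : ∀ {u w v ps} → E H u w → IsPath H w v ps → u ∉ ps → IsPath H u v (u ∷ ps)
  consPath e p u∉ps with IsPath.starts p
  ... | first = record
    { chain = cons e (IsPath.chain p) ; inV = proj₁ (E-end H e) ∷ IsPath.inV p
    ; distinct = ¬Any⇒All¬ _ u∉ps ∷ IsPath.distinct p ; starts = first ; ends = last-cons (IsPath.ends p) }

  tailPath : ∀ {u v x y ys} → IsPath H u v (x ∷ y ∷ ys) → IsPath H y v (y ∷ ys)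
  tailPath p with IsPath.chain p | IsPath.inV p | IsPath.distinct p | IsPath.ends p
  ... | cons _ c | _ ∷ vs | _ ∷ d | last-cons l = record { chain = c ; inV = vs ; distinct = d ; starts = first ; ends = l }

  suffixPath : ∀ {u v z ps} → IsPath H u v ps → z ∈ ps → ∃ λ qs → IsPath H z v qs × qs ⊆ ps
  suffixPath {ps = x ∷ xs} p (here refl) with IsPath.starts p
  ... | first = x ∷ xs , p , λ m → m
  suffixPath {ps = x ∷ y ∷ ys} p (there z∈) with suffixPath (tailPath p) z∈
  ... | qs , q , qs⊆ = qs , q , λ m → there (qs⊆ m)

  walkPath : ∀ {u v} (w : Walk u v) → ∃ λ ps → IsPath H u v ps × ps ⊆ vertices w
  walkPath (stop vu) = _ , singlePath vu , λ m → m
  walkPath {u} (e ◅ w) with walkPath w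
  ... | ps , p , ps⊆w with u ∈? ps
  ...   | yes u∈ps = let qs , q , qs⊆ps = suffixPath p u∈ps in qs , q , λ m → there (ps⊆w (qs⊆ps m))
  ...   | no u∉ps = u ∷ ps , consPath e p u∉ps , λ { (here refl) → here refl ; (there m) → there (ps⊆w m) }

  closedPath-trivial : ∀ {u ps} → IsPath H u u ps → ps ≡ [ u ]
  closedPath-trivial p with IsPath.starts p | IsPath.ends p | IsPath.distinct p
  ... | first | last-one | _ = refl
  ... | first | last-cons l | d = ⊥-elim (Unique[x∷xs]⇒x∉xs d (last-∈ l))

  path-length≥2 : ∀ {u v ps} → IsPath H u v ps → u ≢ v → 2 ≤ length ps
  path-length≥2 {ps = _ ∷ _ ∷ _} _ _ = s≤s (s≤s z≤n)
  path-length≥2 {ps = _ ∷ []} p u≢v with IsPath.starts p | IsPath.ends p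
  ... | first | last-one = ⊥-elim (u≢v refl)

  firstEdge : ∀ {u v x y ys} → IsPath H u v (x ∷ y ∷ ys) → E H x y
  firstEdge p with IsPath.chain p
  ... | cons e _ = e

  module _ (acyclic : ¬ HasCycle H) where

    private
      unique-tail : ∀ {x v} ps qs → IsPath H x v (x ∷ ps) → IsPath H x v (x ∷ qs) → ps ≡ qs
      unique-tail [] [] _ _ = refl
      unique-tail [] (_ ∷ _) P Q with IsPath.ends P
      ... | last-one with closedPath-trivial Q
      ...   | ()
      unique-tail (_ ∷ _) [] P Q with IsPath.ends Q
      ... | last-one with closedPath-trivial P
      ...   | ()
      unique-tail {x} (a ∷ ps) (b ∷ qs) P Q with a ≟ b
      ... | yes refl = cong (a ∷_) (unique-tail ps qs (tailPath P) (tailPath Q))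
      ... | no a≢b = ⊥-elim (acyclic
              (x , b , x ∷ cs , consPath (firstEdge P) cyc x∉cs , s≤s (path-length≥2 cyc a≢b) , E-sym H (firstEdge Q)))
        where
          Wp = pathWalk (tailPath P)
          Wq = pathWalk (tailPath Q)
          found = walkPath (Wp ◅◅ reverse Wq)
          cs = proj₁ found
          cyc = proj₁ (proj₂ found)
          x∉cs : x ∉ cs
          x∉cs m with ∈-++⁻ (vertices Wp) (vertices-◅◅ Wp (reverse Wq) (proj₂ (proj₂ found) m))
          ... | inj₁ m′ = Unique[x∷xs]⇒x∉xs (IsPath.distinct P) (subst (x ∈_) (vertices-pathWalk (tailPath P)) m′)
          ... | inj₂ m′ = Unique[x∷xs]⇒x∉xs (IsPath.distinct Q)
                            (subst (x ∈_) (vertices-pathWalk (tailPath Q)) (vertices-reverse Wq m′))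

    path-unique : ∀ {u v ps qs} → IsPath H u v ps → IsPath H u v qs → ps ≡ qs
    path-unique {ps = x ∷ ps} {y ∷ qs} P Q with IsPath.starts P | IsPath.starts Q
    ... | first | first = cong (x ∷_) (unique-tail ps qs P Q)

    childPath : ∀ {r u c ps} → Child H r u c → IsPath H u r ps → IsPath H c r (c ∷ ps)
    childPath {r} {u} {c} {ps} (e , cs , pc , u∈cs) pu = viaTail cs pc u∈cs
      where
        viaTail : ∀ cs → IsPath H c r cs → u ∈ cs → IsPath H c r (c ∷ ps)
        viaTail cs pc u∈cs with IsPath.starts pc
        viaTail (_ ∷ _) pc (here refl) | first = ⊥-elim (Graph.irrefl G (E⊆G H e))
        viaTail (_ ∷ _ ∷ _) pc (there u∈) | first with suffixPath (tailPath pc) u∈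
        ... | qs , q , qs⊆ with path-unique q pu
        ...   | refl = consPath (E-sym H e) pu (λ c∈ → Unique[x∷xs]⇒x∉xs (IsPath.distinct pc) (qs⊆ c∈))

  root-not-child : ∀ {r u} → ¬ Child H r u r
  root-not-child (e , ps , p , u∈ps) with closedPath-trivial p
  root-not-child (e , _ , _ , here refl) | refl = Graph.irrefl G (E⊆G H e)

  parentPath : ∀ {r u c} → Child H r u c → ∃ λ ps → IsPath H u r ps
  parentPath (_ , _ , pc , u∈) = let qs , q , _ = suffixPath pc u∈ in qs , q

  parent-unique : ¬ HasCycle H → ∀ {r u u′ c} → Child H r u c → Child H r u′ c → u ≡ u′
  parent-unique acyclic ch ch′
    with parentPath ch | parentPath ch′
  ... | ps , p | ps′ , p′ with path-unique acyclic (childPath acyclic ch p) (childPath acyclic ch′ p′)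
  ...   | refl with IsPath.starts p | IsPath.starts p′
  ...     | first | first = refl

  connected-via : ∀ r → (∀ v → V H v → ∃ λ ps → IsPath H v r ps) → Connected H
  connected-via r toRoot u v vu vv =
    let _ , pu = toRoot u vu
        _ , pv = toRoot v vv
        ps , p , _ = walkPath (pathWalk pu ◅◅ reverse (pathWalk pv))
    in ps , p

  pathStart∈V : ∀ {u v ps} → IsPath H u v ps → V H u
  pathStart∈V p with IsPath.starts p | IsPath.inV p
  ... | first | vu ∷ _ = vu

  pathStart∈ : ∀ {u v ps} → IsPath H u v ps → u ∈ ps
  pathStart∈ p with IsPath.starts p
  ... | first = here refl

module _ {n : ℕ} {G : Graph n} where

  restrict : Subgraph G → (Fin n → Set) → Subgraph G
  restrict H P = record
    { V = P ; E = λ u v → E H u v × P u × P v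
    ; E-sym = λ (e , pu , pv) → E-sym H e , pv , pu
    ; E⊆G = λ (e , _) → E⊆G H e ; E-end = λ (_ , pu , pv) → pu , pv }

  restrict-⊑ : ∀ H {P : Fin n → Set} → (∀ v → P v → V H v) → restrict H P ⊑ H
  restrict-⊑ H P⊆V = P⊆V , λ _ _ → proj₁

  chain-map : ∀ {E E′ : Fin n → Fin n → Set} → (∀ {u v} → E u v → E′ u v) → ∀ {ps} → Chain E ps → Chain E′ ps
  chain-map f (single v) = single v
  chain-map f (cons e c) = cons (f e) (chain-map f c)

  path-⊑ : ∀ {J H : Subgraph G} → J ⊑ H → ∀ {u v ps} → IsPath J u v ps → IsPath H u v ps
  path-⊑ (V⊆ , E⊆) p = record
    { chain = chain-map (E⊆ _ _) (IsPath.chain p) ; inV = All.map (V⊆ _) (IsPath.inV p)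
    ; distinct = IsPath.distinct p ; starts = IsPath.starts p ; ends = IsPath.ends p }

  acyclic-⊑ : ∀ {J H : Subgraph G} → J ⊑ H → ¬ HasCycle H → ¬ HasCycle J
  acyclic-⊑ J⊑H acyclic (u , v , ps , p , long , e) = acyclic (u , v , ps , path-⊑ J⊑H p , long , proj₂ J⊑H _ _ e)

  child-⊑ : ∀ {J H : Subgraph G} → J ⊑ H → ∀ {r u v} → Child J r u v → Child H r u v
  child-⊑ J⊑H (e , ps , p , u∈) = proj₂ J⊑H _ _ e , ps , path-⊑ J⊑H p , u∈

  path-restrict : ∀ {H : Subgraph G} {P u v ps} → IsPath H u v ps → All P ps → IsPath (restrict H P) u v ps
  path-restrict {H} {P} p Pps = record
    { chain = restrictChain (IsPath.chain p) Pps ; inV = Pps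
    ; distinct = IsPath.distinct p ; starts = IsPath.starts p ; ends = IsPath.ends p }
    where
      restrictChain : ∀ {ps} → Chain (E H) ps → All P ps → Chain (E (restrict H P)) ps
      restrictChain (single v) _ = single v
      restrictChain (cons e c) (pu ∷ Pvs@(pv ∷ _)) = cons (e , pu , pv) (restrictChain c Pvs)

module _ {A : Set} (kids : A → List A) where

  grow : ℕ → A → List A
  grow zero u = [ u ]
  grow (suc d) u = u ∷ concatMap (grow d) (kids u)

  grow-root : ∀ d u → u ∈ grow d u
  grow-root zero u = here refl
  grow-root (suc d) u = here refl

  grow-kid : ∀ d {u c w} → c ∈ kids u → w ∈ grow d c → w ∈ grow (suc d) u
  grow-kid d c∈ w∈ = there (∈-concatMap⁺ (grow d) (lose c∈ w∈))

  ∈-grow⁻ : ∀ d {u w} → w ∈ grow (suc d) u → w ≡ u ⊎ ∃ λ c → c ∈ kids u × w ∈ grow d c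
  ∈-grow⁻ d (here refl) = inj₁ refl
  ∈-grow⁻ d {u} (there w∈) = inj₂ (find (∈-concatMap⁻ (grow d) {xs = kids u} w∈))

grow-nonroot : ∀ {A : Set} {kids : A → List A} {Q : A → Set} → (∀ {u c} → c ∈ kids u → Q c) →
               ∀ d {u w} → w ∈ grow kids d u → w ≡ u ⊎ Q w
grow-nonroot kids⊆Q zero (here refl) = inj₁ refl
grow-nonroot kids⊆Q (suc d) w∈ with ∈-grow⁻ _ d w∈
... | inj₁ w≡u = inj₁ w≡u
... | inj₂ (c , c∈ , w∈′) with grow-nonroot kids⊆Q d w∈′
...   | inj₁ refl = inj₂ (kids⊆Q c∈)
...   | inj₂ Qw = inj₂ Qw

fullTreeSize : ℕ → ℕ → ℕ
fullTreeSize ζ zero = 1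
fullTreeSize ζ (suc d) = suc (ζ * fullTreeSize ζ d)

grow-length : ∀ {A : Set} {kids : A → List A} {ζ} → (∀ u → length (kids u) ≤ ζ) →
              ∀ d u → length (grow kids d u) ≤ fullTreeSize ζ d
grow-length kids≤ zero u = ≤-refl
grow-length {kids = kids} {ζ} kids≤ (suc d) u =
  s≤s (≤-trans (length-concatMap≤ (grow kids d) (grow-length kids≤ d) (kids u)) (*-monoˡ-≤ (fullTreeSize ζ d) (kids≤ u)))

grow-cong : ∀ {A : Set} {kids kids′ : A → List A} → (∀ u → kids u ≡ kids′ u) →
            ∀ d u → grow kids d u ≡ grow kids′ d u
grow-cong same zero u = refl
grow-cong {kids = kids} {kids′} same (suc d) u =
  cong (u ∷_) (trans (cong (concatMap (grow kids d)) (same u)) (concatMap-cong (grow-cong same d) (kids′ u)))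

module AvoidingKids {n : ℕ} (ζ : ℕ) (X : List (Fin n)) (C : Fin n → List (Fin n)) where
  open import Data.List.Membership.DecPropositional (_≟_ {n}) using (_∉?_)

  kids : Fin n → List (Fin n)
  kids u = take ζ (filter (_∉? X) (C u))

  ∈-kids⁻ : ∀ {u c} → c ∈ kids u → c ∈ C u × c ∉ X
  ∈-kids⁻ {u} c∈ = ∈-filter⁻ (_∉? X) (lookup (take-⊆ ζ (filter (_∉? X) (C u))) c∈)

  kids-unique : ∀ {u} → Unique (C u) → Unique (kids u)
  kids-unique uC = take⁺ ζ (filter⁺ (_∉? X) uC)

  length-kids≤ : ∀ u → length (kids u) ≤ ζ
  length-kids≤ u = subst (_≤ ζ) (sym (length-take ζ (filter (_∉? X) (C u)))) (m⊓n≤m ζ _)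

  length-kids : ∀ {u} → Unique (C u) → ζ + length X ≤ length (C u) → length (kids u) ≡ ζ
  length-kids {u} uC room = trans (length-take ζ _) (m≤n⇒m⊓n≡m
    (+-cancelʳ-≤ (length X) ζ _ (≤-trans room (length≤length-filter-∉+length _≟_ X uC))))

kids-cong : ∀ {n} ζ X {C₁ C₂ : Fin n → List (Fin n)} → (∀ u → C₁ u ≡ C₂ u) →
            ∀ u → AvoidingKids.kids ζ X C₁ u ≡ AvoidingKids.kids ζ X C₂ u
kids-cong ζ X same u = cong (λ xs → AvoidingKids.kids ζ X (λ _ → xs) u) (same u)

fullTreeSize<pow : ∀ {ζ} → 2 ≤ ζ → ∀ d → fullTreeSize ζ d < ζ ^ suc d
fullTreeSize<pow {ζ} ζ≥2 zero = subst (2 ≤_) (sym (*-identityʳ ζ)) ζ≥2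
fullTreeSize<pow {ζ} ζ≥2 (suc d) = begin
  suc (suc (ζ * fullTreeSize ζ d)) ≤⟨ +-monoˡ-≤ (ζ * fullTreeSize ζ d) ζ≥2 ⟩
  ζ + ζ * fullTreeSize ζ d         ≡⟨ *-suc ζ (fullTreeSize ζ d) ⟨
  ζ * suc (fullTreeSize ζ d)       ≤⟨ *-monoʳ-≤ ζ (fullTreeSize<pow ζ≥2 d) ⟩
  ζ * ζ ^ suc d                    ∎
  where open ≤-Reasoning

room-bound : ∀ {ζ η j k x} → 2 ≤ ζ → j < k → x ≤ j * fullTreeSize ζ η → ζ + x ≤ k * ζ ^ (η + 1)
room-bound {ζ@(suc ζ′)} {η} {j} {suc k′} {x} ζ≥2 (s≤s j≤k′) x≤ = begin
  ζ + x                              ≤⟨ +-mono-≤ ζ≤P (≤-trans x≤ (*-mono-≤ j≤k′ S≤P)) ⟩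
  ζ ^ suc η + k′ * ζ ^ suc η         ≡⟨ cong (λ e → ζ ^ e + k′ * ζ ^ e) (+-comm 1 η) ⟩
  suc k′ * ζ ^ (η + 1)               ∎
  where
    open ≤-Reasoning
    S≤P : fullTreeSize ζ η ≤ ζ ^ suc η
    S≤P = <⇒≤ (fullTreeSize<pow ζ≥2 η)
    ζ≤P : ζ ≤ ζ ^ suc η
    ζ≤P = m≤m*n ζ (ζ ^ η) {{m^n≢0 ζ η}}

module GrownSubtree {n} {G : Graph n} (H : Subgraph G) (r : Fin n) (r∈H : V H r) (acyclic : ¬ HasCycle H)
  {η ζ m : ℕ} (uniform : Uniform H r m η) (X : List (Fin n)) (C : Fin n → List (Fin n))
  (C-children : ∀ u v → Child H r u v ⇔ v ∈ C u) (C-unique : ∀ u → Unique (C u)) (room : ζ + length X ≤ m) where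

  open Paths H

  open AvoidingKids ζ X C using (kids; ∈-kids⁻)

  subtree : List (Fin n)
  subtree = grow kids η r

  kid-child : ∀ {u c} → c ∈ kids u → Child H r u c
  kid-child {u} {c} c∈ = Equivalence.from (C-children u c) (proj₁ (∈-kids⁻ c∈))

  child? : ∀ u → Dec (∃ (Child H r u))
  child? u with C u in eq
  ... | [] = no λ (v , ch) → ¬Any[] (subst (v ∈_) eq (Equivalence.to (C-children u v) ch))
  ... | c ∷ _ = yes (c , Equivalence.from (C-children u c) (subst (c ∈_) (sym eq) (here refl)))

  kids-count : ∀ {u} → V H u → ∃ (Child H r u) → length (kids u) ≡ ζ
  kids-count {u} u∈H ch = AvoidingKids.length-kids ζ X C (C-unique u)
    (subst (ζ + length X ≤_) (sym (HasExactly⇒length≡ (proj₁ uniform u u∈H ch) (C-unique u) (C-children u))) room)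

  -- u is a vertex of the subtree below which d more levels are grown.
  record Node (u : Fin n) (d : ℕ) : Set where
    field
      rootPath   : List (Fin n)
      isRootPath : IsPath H u r rootPath
      height     : length rootPath + d ≡ suc η
      below⊆     : grow kids d u ⊆ subtree
      rootPath⊆  : rootPath ⊆ subtree
  open Node

  root-node : Node r η
  root-node = record
    { rootPath = [ r ] ; isRootPath = singlePath r∈H ; height = refl
    ; below⊆ = λ m → m ; rootPath⊆ = λ { (here refl) → grow-root kids η r } }

  kid-node : ∀ {u d c} → Node u (suc d) → c ∈ kids u → Node c d
  kid-node {u} {d} {c} node c∈ = record
    { rootPath = c ∷ rootPath node
    ; isRootPath = childPath acyclic (kid-child c∈) (isRootPath node)
    ; height = trans (sym (+-suc (length (rootPath node)) d)) (height node)
    ; below⊆ = λ m → below⊆ node (grow-kid kids d c∈ m)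
    ; rootPath⊆ = λ { (here refl) → below⊆ node (grow-kid kids d c∈ (grow-root kids d c)) ; (there m) → rootPath⊆ node m } }

  node-of : ∀ {u w} d → Node u d → w ∈ grow kids d u → ∃ (Node w)
  node-of zero node (here refl) = zero , node
  node-of (suc d) node w∈ with ∈-grow⁻ kids d w∈
  ... | inj₁ refl = suc d , node
  ... | inj₂ (c , c∈ , w∈′) = node-of d (kid-node node c∈) w∈′

  parent-of : ∀ {u w} d → Node u d → w ∈ grow kids d u →
              w ≡ u ⊎ ∃₂ λ u′ d′ → Node u′ (suc d′) × w ∈ kids u′
  parent-of zero node (here refl) = inj₁ refl
  parent-of (suc d) node w∈ with ∈-grow⁻ kids d w∈
  ... | inj₁ w≡u = inj₁ w≡u
  ... | inj₂ (c , c∈ , w∈′) with parent-of d (kid-node node c∈) w∈′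
  ...   | inj₁ refl = inj₂ (_ , d , node , c∈)
  ...   | inj₂ found = inj₂ found

  inner-node-has-child : ∀ {u d} → Node u (suc d) → ∃ (Child H r u)
  inner-node-has-child {u} {d} node with child? u
  ... | yes ch = ch
  ... | no leaf with proj₂ uniform u (pathStart∈V (isRootPath node)) leaf
  ...   | ps , p , len with path-unique acyclic p (isRootPath node)
  ...     | refl = ⊥-elim (m+1+n≢m (length ps) (trans (height node) (sym len)))

  module Restricted (P : Fin n → Set) (P⇔subtree : ∀ v → P v ⇔ v ∈ subtree) where

    P→subtree : ∀ {v} → P v → v ∈ subtree
    P→subtree {v} = Equivalence.to (P⇔subtree v)

    subtree→P : ∀ {v} → v ∈ subtree → P v
    subtree→P {v} = Equivalence.from (P⇔subtree v)

    H′ : Subgraph G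
    H′ = restrict H P

    H′⊑H : H′ ⊑ H
    H′⊑H = restrict-⊑ H λ v Pv → let _ , node = node-of η root-node (P→subtree Pv) in pathStart∈V (isRootPath node)

    node-path : ∀ {u d} (node : Node u d) → IsPath H′ u r (rootPath node)
    node-path node = path-restrict (isRootPath node) (All.tabulate λ m → subtree→P (rootPath⊆ node m))

    kid-child′ : ∀ {u d c} → Node u (suc d) → c ∈ kids u → Child H′ r u c
    kid-child′ {u} node c∈ =
      (proj₁ (kid-child c∈) , subtree→P (rootPath⊆ node u∈path) , subtree→P (rootPath⊆ cnode (here refl)))
      , rootPath cnode , node-path cnode , there u∈path
      where
        cnode = kid-node node c∈
        u∈path = pathStart∈ (isRootPath node)

    parent-node : ∀ {u w} → Child H′ r u w → ∃ λ d → Node u (suc d) × w ∈ kids u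
    parent-node ch@((_ , _ , Pw) , _) with parent-of η root-node (P→subtree Pw)
    ... | inj₁ refl = ⊥-elim (Paths.root-not-child H′ ch)
    ... | inj₂ (u′ , d , node , w∈) with parent-unique acyclic (kid-child w∈) (child-⊑ H′⊑H ch)
    ...   | refl = d , node , w∈

    interior-uniform : ∀ {u v} → Child H′ r u v → HasExactly (Child H′ r u) ζ
    interior-uniform ch with parent-node ch
    ... | d , node , _ =
      kids _ , kids-count (pathStart∈V (isRootPath node)) (_ , child-⊑ H′⊑H ch) , AvoidingKids.kids-unique ζ X C (C-unique _)
      , λ w → mk⇔ (λ chw → proj₂ (proj₂ (parent-node chw))) (kid-child′ node)

    leaf-depth : 1 ≤ ζ → ∀ {u} → P u → ¬ ∃ (Child H′ r u) → ∃ λ ps → IsPath H′ u r ps × length ps ≡ suc η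
    leaf-depth ζ≥1 Pu leaf with node-of η root-node (P→subtree Pu)
    ... | zero , node = rootPath node , node-path node , trans (sym (+-identityʳ _)) (height node)
    ... | suc d , node = ⊥-elim (leaf (_ , kid-child′ node (proj₂ (nonempty (subst (1 ≤_) (sym kids≡ζ) ζ≥1)))))
      where
        kids≡ζ = kids-count (pathStart∈V (isRootPath node)) (inner-node-has-child node)
        nonempty : ∀ {xs : List (Fin n)} → 1 ≤ length xs → ∃ (_∈ xs)
        nonempty {_ ∷ _} _ = _ , here refl

    reaches-root : ∀ {v} → P v → ∃ λ ps → IsPath H′ v r ps
    reaches-root Pv = let _ , node = node-of η root-node (P→subtree Pv) in rootPath node , node-path node

    root-not-leaf : 1 ≤ ζ → 1 ≤ η → ¬ ¬ ∃ (Child H′ r r)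
    root-not-leaf ζ≥1 η≥1 leaf with leaf-depth ζ≥1 (subtree→P (grow-root kids η r)) leaf
    ... | ps , p , len with Paths.closedPath-trivial H′ p
    root-not-leaf ζ≥1 (s≤s z≤n) leaf | _ , _ , () | refl

¬¬-Π-Fin : ∀ {k} {P : Fin k → Set} → (∀ i → ¬ ¬ P i) → ¬ ¬ (∀ i → P i)
¬¬-Π-Fin {zero} _ ¬all = ¬all λ ()
¬¬-Π-Fin {suc k} f ¬all = f zero λ p₀ → ¬¬-Π-Fin (f ∘ suc) λ ps → ¬all λ { zero → p₀ ; (suc i) → ps i }

¬¬-choice-Fin : ∀ {k} {B : Fin k → Set} {C : ∀ i → B i → Set} →
                (∀ i → ¬ ¬ Σ (B i) (C i)) → ¬ ¬ Σ (∀ i → B i) λ f → ∀ i → C i (f i)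
¬¬-choice-Fin choices = ¬¬-map (λ f → proj₁ ∘ f , proj₂ ∘ f) (¬¬-Π-Fin choices)

ChildList : ∀ {n} {G : Graph n} → Subgraph G → Fin n → (Fin n → List (Fin n)) → Set
ChildList H r L = ∀ u v → Child H r u v ⇔ v ∈ L u

module _ {n : ℕ} where
  open import Data.List.Membership.DecPropositional (_≟_ {n}) using (_∈?_)

  -- Listing the members in the order of allFin n makes the result depend on membership only.
  canonical : (Fin n → List (Fin n)) → Fin n → List (Fin n)
  canonical L u = filter (_∈? L u) (allFin n)

  canonical-unique : ∀ L u → Unique (canonical L u)
  canonical-unique L u = filter⁺ (_∈? L u) (allFin⁺ n)

module _ {n} {G : Graph n} {H : Subgraph G} {r : Fin n} where

  childList-¬¬ : ∀ {m η} → Uniform H r m η → ¬ ¬ Σ _ (ChildList H r)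
  childList-¬¬ uniform = ¬¬-choice-Fin λ u → ¬¬-map (childrenOf u) ¬¬-excluded-middle
    where
      childrenOf : ∀ u → Dec (∃ (Child H r u)) → Σ (List (Fin n)) λ xs → ∀ v → Child H r u v ⇔ v ∈ xs
      childrenOf u (yes ch@(_ , (e , _))) = let xs , _ , _ , iff = proj₁ uniform u (proj₁ (E-end H e)) ch in xs , iff
      childrenOf u (no leaf) = [] , λ v → mk⇔ (λ ch → ⊥-elim (leaf (v , ch))) λ ()

  open import Data.List.Membership.DecPropositional (_≟_ {n}) using (_∈?_)

  canonical-childList : ∀ {L} → ChildList H r L → ChildList H r (canonical L)
  canonical-childList {L} cl u v = mk⇔
    (λ ch → ∈-filter⁺ (_∈? L u) (∈-allFin v) (Equivalence.to (cl u v) ch))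
    (λ v∈ → Equivalence.from (cl u v) (proj₂ (∈-filter⁻ (_∈? L u) {xs = allFin n} v∈)))

  canonical-agree : ∀ {L₁ L₂} → ChildList H r L₁ → ChildList H r L₂ → ∀ u → canonical L₁ u ≡ canonical L₂ u
  canonical-agree {L₁} {L₂} cl₁ cl₂ u = filter-≐ (_∈? L₁ u) (_∈? L₂ u)
    ( (λ {v} v∈ → Equivalence.to (cl₂ u v) (Equivalence.from (cl₁ u v) v∈))
    , (λ {v} v∈ → Equivalence.to (cl₁ u v) (Equivalence.from (cl₂ u v) v∈)) )
    (allFin n)

module Greedy {n : ℕ} {G : Graph n} {k ζ η : ℕ} (ζ≥2 : 2 ≤ ζ) (η≥1 : 1 ≤ η)
  (H : Fin k → Subgraph G) (r : Fin k → Fin n)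
  (trees : ∀ i → IsRootedTree (H i) (r i))
  (uniform : ∀ i → Uniform (H i) (r i) (k * ζ ^ (η + 1)) η)
  (roots-apart : ∀ i j → i ≢ j → ¬ V (H j) (r i)) where

  acyclic : ∀ i → ¬ HasCycle (H i)
  acyclic i = proj₂ (proj₂ (proj₁ (trees i)))

  r∈H : ∀ i → V (H i) (r i)
  r∈H i = proj₂ (trees i)

  ChildLists : Set
  ChildLists = Fin k → Fin n → List (Fin n)

  Certified : ChildLists → Set
  Certified L = ∀ i → ChildList (H i) (r i) (L i)

  certified-¬¬ : ¬ ¬ Σ ChildLists Certified
  certified-¬¬ = ¬¬-choice-Fin λ i → childList-¬¬ (uniform i)

  grownTree : ChildLists → Fin k → List (Fin n) → List (Fin n)
  grownTree L i X = grow (AvoidingKids.kids ζ X (canonical (L i))) η (r i)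

  treeAt : ChildLists → ℕ → List (Fin n) → List (Fin n)
  treeAt L j X with j <? k
  ... | yes j<k = grownTree L (fromℕ< j<k) X
  ... | no _ = []

  forbidden : ChildLists → ℕ → List (Fin n)
  forbidden L zero = []
  forbidden L (suc j) = forbidden L j ++ treeAt L j (forbidden L j)

  tree : ChildLists → Fin k → List (Fin n)
  tree L i = grownTree L i (forbidden L (toℕ i))

  treeAt-toℕ : ∀ L i X → treeAt L (toℕ i) X ≡ grownTree L i X
  treeAt-toℕ L i X with toℕ i <? k
  ... | yes i<k = cong (λ i′ → grownTree L i′ X) (fromℕ<-toℕ i i<k)
  ... | no i≮k = ⊥-elim (i≮k (toℕ<n i))

  length-forbidden : ∀ L j → length (forbidden L j) ≤ j * fullTreeSize ζ η
  length-forbidden L zero = z≤n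
  length-forbidden L (suc j) = begin
    length (forbidden L j ++ treeAt L j (forbidden L j))           ≡⟨ length-++ (forbidden L j) ⟩
    length (forbidden L j) + length (treeAt L j (forbidden L j))   ≤⟨ +-mono-≤ (length-forbidden L j) (length-treeAt j _) ⟩
    j * fullTreeSize ζ η + fullTreeSize ζ η                        ≡⟨ +-comm (j * fullTreeSize ζ η) _ ⟩
    suc j * fullTreeSize ζ η                                       ∎
    where
      open ≤-Reasoning
      length-treeAt : ∀ j X → length (treeAt L j X) ≤ fullTreeSize ζ η
      length-treeAt j X with j <? k
      ... | yes j<k = grow-length (AvoidingKids.length-kids≤ ζ X (canonical (L (fromℕ< j<k)))) η _
      ... | no _ = z≤n

  tree⊆forbidden : ∀ L i j → toℕ i < j → tree L i ⊆ forbidden L j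
  tree⊆forbidden L i (suc j) (s≤s i≤j) v∈ with m≤n⇒m<n∨m≡n i≤j
  ... | inj₁ i<j = ∈-++⁺ˡ (tree⊆forbidden L i j i<j v∈)
  ... | inj₂ refl = ∈-++⁺ʳ (forbidden L (toℕ i)) (subst (_ ∈_) (sym (treeAt-toℕ L i (forbidden L (toℕ i)))) v∈)

  module _ {L₁ L₂ : ChildLists} (c₁ : Certified L₁) (c₂ : Certified L₂) where

    grownTree-agree : ∀ i X → grownTree L₁ i X ≡ grownTree L₂ i X
    grownTree-agree i X = grow-cong (kids-cong ζ X (canonical-agree (c₁ i) (c₂ i))) η (r i)

    treeAt-agree : ∀ j X → treeAt L₁ j X ≡ treeAt L₂ j X
    treeAt-agree j X with j <? k
    ... | yes j<k = grownTree-agree (fromℕ< j<k) X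
    ... | no _ = refl

    forbidden-agree : ∀ j → forbidden L₁ j ≡ forbidden L₂ j
    forbidden-agree zero = refl
    forbidden-agree (suc j) rewrite forbidden-agree j = cong (forbidden L₂ j ++_) (treeAt-agree j (forbidden L₂ j))

    tree-agree : ∀ i → tree L₁ i ≡ tree L₂ i
    tree-agree i rewrite forbidden-agree (toℕ i) = grownTree-agree i _

  room : ∀ L i → ζ + length (forbidden L (toℕ i)) ≤ k * ζ ^ (η + 1)
  room L i = room-bound {j = toℕ i} {k = k} ζ≥2 (toℕ<n i) (length-forbidden L (toℕ i))

  -- Child is not decidable, so child lists to run the construction on exist only under double
  -- negation. A vertex is admitted through any certified family; all of them grow the same
  -- trees (tree-agree), and the root, admitted without one, only needs facts whose conclusion
  -- is ⊥.
  V′ : Fin k → Fin n → Set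
  V′ i v = v ≡ r i ⊎ ∃ λ L → Certified L × v ∈ tree L i

  V′⇔tree : ∀ {L} → Certified L → ∀ i v → V′ i v ⇔ v ∈ tree L i
  V′⇔tree {L} c i v = mk⇔
    (λ { (inj₁ refl) → grow-root _ η (r i) ; (inj₂ (L′ , c′ , v∈)) → subst (v ∈_) (tree-agree c′ c i) v∈ })
    (λ v∈ → inj₂ (L , c , v∈))

  module Grown (L : ChildLists) (c : Certified L) (i : Fin k) =
    GrownSubtree.Restricted (H i) (r i) (r∈H i) (acyclic i) (uniform i) (forbidden L (toℕ i)) (canonical (L i))
      (canonical-childList (c i)) (canonical-unique (L i)) (room L i) (V′ i) (V′⇔tree c i)

  H′ : Fin k → Subgraph G
  H′ i = restrict (H i) (V′ i)

  V′⊆H : ∀ i v → V′ i v → V (H i) v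
  V′⊆H i v (inj₁ refl) = r∈H i
  V′⊆H i v P@(inj₂ (L , c , _)) = proj₁ (Grown.H′⊑H L c i) v P

  H′⊑H : ∀ i → H′ i ⊑ H i
  H′⊑H i = restrict-⊑ (H i) (V′⊆H i)

  H′-tree : ∀ i → IsTree (H′ i)
  H′-tree i = (r i , inj₁ refl) , Paths.connected-via (H′ i) (r i) reaches-root , acyclic-⊑ (H′⊑H i) (acyclic i)
    where
      reaches-root : ∀ v → V′ i v → ∃ λ ps → IsPath (H′ i) v (r i) ps
      reaches-root v (inj₁ refl) = [ r i ] , Paths.singlePath (H′ i) (inj₁ refl)
      reaches-root v P@(inj₂ (L , c , _)) = Grown.reaches-root L c i P

  H′-uniform : ∀ i → Uniform (H′ i) (r i) ζ η
  H′-uniform i = interior , leaf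
    where
      interior : ∀ u → V′ i u → ∃ (Child (H′ i) (r i) u) → HasExactly (Child (H′ i) (r i) u) ζ
      interior u _ (v , ch@((_ , _ , inj₁ refl) , _)) = ⊥-elim (Paths.root-not-child (H′ i) ch)
      interior u _ (v , ch@((_ , _ , inj₂ (L , c , _)) , _)) = Grown.interior-uniform L c i ch
      leaf : ∀ u → V′ i u → ¬ ∃ (Child (H′ i) (r i) u) → ∃ λ ps → IsPath (H′ i) u (r i) ps × length ps ≡ suc η
      leaf u (inj₁ refl) isLeaf = ⊥-elim (certified-¬¬ λ (L , c) → Grown.root-not-leaf L c i (<⇒≤ ζ≥2) η≥1 isLeaf)
      leaf u P@(inj₂ (L , c , _)) isLeaf = Grown.leaf-depth L c i (<⇒≤ ζ≥2) P isLeaf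

  trees-disjoint< : ∀ {L} → Certified L → ∀ {i j v} → toℕ i < toℕ j → v ∈ tree L i → v ∈ tree L j → ⊥
  trees-disjoint< {L} c {i} {j} i<j v∈i v∈j
    with grow-nonroot (λ c∈ → proj₂ (AvoidingKids.∈-kids⁻ ζ (forbidden L (toℕ j)) (canonical (L j)) c∈)) η v∈j
  ... | inj₁ refl = roots-apart j i (λ j≡i → <⇒≢ i<j (cong toℕ (sym j≡i))) (V′⊆H i _ (inj₂ (L , c , v∈i)))
  ... | inj₂ v∉ = v∉ (tree⊆forbidden L i (toℕ j) i<j v∈i)

  disjoint : ∀ i j → i ≢ j → ∀ v → V′ i v → V′ j v → ⊥
  disjoint i j i≢j v (inj₁ refl) Vj = roots-apart i j i≢j (V′⊆H j v Vj)
  disjoint i j i≢j v Vi (inj₁ refl) = roots-apart j i (≢-sym i≢j) (V′⊆H i v Vi)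
  disjoint i j i≢j v (inj₂ (L , c , v∈i)) (inj₂ (L′ , c′ , v∈j)) with <-cmp (toℕ i) (toℕ j)
  ... | tri< i<j _ _ = trees-disjoint< c i<j v∈i (subst (v ∈_) (tree-agree c′ c j) v∈j)
  ... | tri≈ _ i≡j _ = i≢j (toℕ-injective i≡j)
  ... | tri> _ _ j<i = trees-disjoint< c j<i (subst (v ∈_) (tree-agree c′ c j) v∈j) v∈i

mainTheorem1 : ∀ {n : ℕ} (G : Graph n) (k ζ η : ℕ) → 1 ≤ k → 2 ≤ ζ → 1 ≤ η →
    (H : Fin k → Subgraph G) (r : Fin k → Fin n) →
    (∀ i → IsRootedTree (H i) (r i)) →
    (∀ i → Uniform (H i) (r i) (k * ζ ^ (η + 1)) η) →
    (∀ i j → i ≢ j → ¬ V (H j) (r i)) →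
    Σ (Fin k → Subgraph G) λ H′ →
    (∀ i → IsRootedSubtree (H′ i) (H i) (r i) × Uniform (H′ i) (r i) ζ η)
    × (∀ i j → i ≢ j → ∀ v → V (H′ i) v → V (H′ j) v → ⊥)
mainTheorem1 G k ζ η _ ζ≥2 η≥1 H r trees uniform roots-apart =
  H′ , (λ i → (H′-tree i , H′⊑H i , inj₁ refl) , H′-uniform i) , disjoint
  where open Greedy ζ≥2 η≥1 H r trees uniform roots-apart
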